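{- For atomic steps $a,b$ and command $c$: $a^\star;c \otimes b^\infty = (a\otimes b)^\star;(c \otimes b^\infty)$.
   Context: Commands form a complete distributive lattice under refinement with nondeterministic choice $\sqcap$, infeasible command $\top$; sequential composition $;$ (binding tighter than $\otimes$) is associative with identity $\mathbf{nil}$, distributes over arbitrary choices on the right and non-empty choices on the left. Iterations: $c^\star = \nu x.\,\mathbf{nil}\sqcap c;x$ (so $c^\star=\sqcap_{i\in\mathbb N}c^i$), $c^\omega = \mu x.\,\mathbf{nil}\sqcap c;x$, $c^\infty = c^\omega;\top$ (so $c^\infty = c^i;c^\infty$ for all $i$). A synchronisation operator $\otimes$ is associative, commutative, distributes over non-empty nondeterministic choices, is closed on atomic steps, and satisfies $(a;c)\otimes(b;d) = (a\otimes b);(c\otimes d)$ for atomic $a,b$. -}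

module Defs where

open import Level using (Level; _⊔_; Lift; lift; lower) renaming (suc to lsuc)
open import Data.Nat using (ℕ; zero; suc)
open import Relation.Binary.Structures using (IsPartialOrder)

-- Refinement order: c ⊑ d  means "d refines c";  c ⊓ d ⊑ c,  c ⊑ ⊤ (⊤ = infeasible, greatest).
-- Arbitrary (possibly infinite) choices are indexed meets  ⨅ f  over index types I : Set i.
record CommandAlgebra (c ℓ₁ ℓ₂ i : Level) : Set (lsuc (c ⊔ ℓ₁ ⊔ ℓ₂ ⊔ i)) where
  infixr 6 _⊗_
  infixr 7 _⨾_
  infixr 5 _⊓_
  infixr 5 _⊔ᶜ_
  infix 4 _≈_ _⊑_
  field
    Carrier : Set c
    _≈_     : Carrier → Carrier → Set ℓ₁
    _⊑_     : Carrier → Carrier → Set ℓ₂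
    isPartialOrder : IsPartialOrder _≈_ _⊑_

    _⊓_  : Carrier → Carrier → Carrier
    _⊔ᶜ_ : Carrier → Carrier → Carrier
    ⨅    : {I : Set i} → (I → Carrier) → Carrier
    ⨆    : {I : Set i} → (I → Carrier) → Carrier
    ⊤    : Carrier
    ⊓-lb₁ : ∀ x y → x ⊓ y ⊑ x
    ⊓-lb₂ : ∀ x y → x ⊓ y ⊑ y
    ⊓-glb : ∀ {x y z} → z ⊑ x → z ⊑ y → z ⊑ x ⊓ y
    ⊔-ub₁ : ∀ x y → x ⊑ x ⊔ᶜ y
    ⊔-ub₂ : ∀ x y → y ⊑ x ⊔ᶜ y
    ⊔-lub : ∀ {x y z} → x ⊑ z → y ⊑ z → x ⊔ᶜ y ⊑ z
    ⨅-lb  : ∀ {I : Set i} (f : I → Carrier) (j : I) → ⨅ f ⊑ f j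
    ⨅-glb : ∀ {I : Set i} (f : I → Carrier) {x} → (∀ j → x ⊑ f j) → x ⊑ ⨅ f
    ⨆-ub  : ∀ {I : Set i} (f : I → Carrier) (j : I) → f j ⊑ ⨆ f
    ⨆-lub : ∀ {I : Set i} (f : I → Carrier) {x} → (∀ j → f j ⊑ x) → ⨆ f ⊑ x
    ⊤-max : ∀ x → x ⊑ ⊤
    ⊓-distrib-⨆ : ∀ {I : Set i} x (f : I → Carrier) → x ⊓ ⨆ f ≈ ⨆ (λ j → x ⊓ f j)
    ⊔-distrib-⨅ : ∀ {I : Set i} x (f : I → Carrier) → x ⊔ᶜ ⨅ f ≈ ⨅ (λ j → x ⊔ᶜ f j)

    _⨾_   : Carrier → Carrier → Carrier
    nil   : Carrier
    ⨾-cong  : ∀ {x x' y y'} → x ≈ x' → y ≈ y' → x ⨾ y ≈ x' ⨾ y'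
    ⨾-assoc : ∀ x y z → (x ⨾ y) ⨾ z ≈ x ⨾ (y ⨾ z)
    ⨾-idˡ   : ∀ x → nil ⨾ x ≈ x
    ⨾-idʳ   : ∀ x → x ⨾ nil ≈ x
    ⨾-distrib-⨅ʳ : ∀ {I : Set i} (f : I → Carrier) d → (⨅ f) ⨾ d ≈ ⨅ (λ j → f j ⨾ d)
    -- c ; (⨅ D) = ⨅ (c ; d)  for non-empty D
    ⨾-distrib-⨅ˡ : ∀ {I : Set i} → I → ∀ x (f : I → Carrier) → x ⨾ (⨅ f) ≈ ⨅ (λ j → x ⨾ f j)
    ⨾-distrib-⊓ʳ : ∀ x y z → (x ⊓ y) ⨾ z ≈ (x ⨾ z) ⊓ (y ⨾ z)
    ⨾-distrib-⊓ˡ : ∀ x y z → x ⨾ (y ⊓ z) ≈ (x ⨾ y) ⊓ (x ⨾ z)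

    _^ω : Carrier → Carrier
    ω-unfold : ∀ x → x ^ω ≈ nil ⊓ x ⨾ (x ^ω)
    ω-induct : ∀ x y → nil ⊓ x ⨾ y ⊑ y → x ^ω ⊑ y

    Atomic : Carrier → Set c
    _⊗_    : Carrier → Carrier → Carrier
    ⊗-cong  : ∀ {x x' y y'} → x ≈ x' → y ≈ y' → x ⊗ y ≈ x' ⊗ y'
    ⊗-assoc : ∀ x y z → (x ⊗ y) ⊗ z ≈ x ⊗ (y ⊗ z)
    ⊗-comm  : ∀ x y → x ⊗ y ≈ y ⊗ x
    ⊗-distrib-⨅ : ∀ {I : Set i} → I → (f : I → Carrier) → ∀ d → (⨅ f) ⊗ d ≈ ⨅ (λ j → f j ⊗ d)
    ⊗-distrib-⊓ : ∀ x y z → (x ⊓ y) ⊗ z ≈ (x ⊗ z) ⊓ (y ⊗ z)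
    ⊗-atomic : ∀ {a b} → Atomic a → Atomic b → Atomic (a ⊗ b)
    ⊗-interchange : ∀ {a b} → Atomic a → Atomic b → ∀ x y →
                    (a ⨾ x) ⊗ (b ⨾ y) ≈ (a ⊗ b) ⨾ (x ⊗ y)

  _^_ : Carrier → ℕ → Carrier
  x ^ zero  = nil
  x ^ suc n = x ⨾ (x ^ n)

  -- finite iteration  c^⋆ = ⨅_{i ∈ ℕ} c^i  (= ν x. nil ⊓ c ; x)
  _^⋆ : Carrier → Carrier
  x ^⋆ = ⨅ {I = Lift i ℕ} (λ n → x ^ lower n)

  _^∞ : Carrier → Carrier
  x ^∞ = (x ^ω) ⨾ ⊤

{-# OPTIONS --safe #-}
module Submission where

open import Defs
open import Level using (Level; lift; lower)
open import Data.Nat using (zero; suc)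
open import Relation.Binary.Bundles using (Setoid)
open import Relation.Binary.Structures using (IsPartialOrder)
import Relation.Binary.Reasoning.Setoid as SetoidReasoning

-- Since b^∞ = b ; b^∞, the interchange law lets each finite unrolling a^n ; x synchronise
-- with b^∞ one atomic step at a time; both ⊗ and ; distribute over the non-empty choice
-- a^⋆ = ⨅ₙ a^n, so the finite cases assemble into the theorem.

module CommandAlgebraProperties {c ℓ₁ ℓ₂ i : Level} (C : CommandAlgebra c ℓ₁ ℓ₂ i) where
  open CommandAlgebra C
  open IsPartialOrder isPartialOrder
    using (antisym; reflexive; isEquivalence; module Eq) renaming (trans to ⊑-trans)

  setoid : Setoid c ℓ₁
  setoid = record { isEquivalence = isEquivalence }

  open SetoidReasoning setoid

  ⊓-mono : ∀ {x x′ y y′} → x ⊑ x′ → y ⊑ y′ → x ⊓ y ⊑ x′ ⊓ y′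
  ⊓-mono {x} {_} {y} x⊑x′ y⊑y′ =
    ⊓-glb (⊑-trans (⊓-lb₁ x y) x⊑x′) (⊑-trans (⊓-lb₂ x y) y⊑y′)

  ⊓-cong : ∀ {x x′ y y′} → x ≈ x′ → y ≈ y′ → x ⊓ y ≈ x′ ⊓ y′
  ⊓-cong x≈x′ y≈y′ = antisym
    (⊓-mono (reflexive x≈x′) (reflexive y≈y′))
    (⊓-mono (reflexive (Eq.sym x≈x′)) (reflexive (Eq.sym y≈y′)))

  ⨅-mono : ∀ {I : Set i} {f g : I → Carrier} → (∀ j → f j ⊑ g j) → ⨅ f ⊑ ⨅ g
  ⨅-mono {f = f} {g} f⊑g = ⨅-glb g (λ j → ⊑-trans (⨅-lb f j) (f⊑g j))

  ⨅-cong : ∀ {I : Set i} {f g : I → Carrier} → (∀ j → f j ≈ g j) → ⨅ f ≈ ⨅ g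
  ⨅-cong f≈g = antisym
    (⨅-mono (λ j → reflexive (f≈g j)))
    (⨅-mono (λ j → reflexive (Eq.sym (f≈g j))))

  ⊓-identityˡ : ∀ x → ⊤ ⊓ x ≈ x
  ⊓-identityˡ x = antisym (⊓-lb₂ ⊤ x) (⊓-glb (⊤-max x) (reflexive Eq.refl))

  ^∞-unfold : ∀ x → x ^∞ ≈ x ⨾ x ^∞
  ^∞-unfold x = begin
    x ^ω ⨾ ⊤                    ≈⟨ ⨾-cong (ω-unfold x) Eq.refl ⟩
    (nil ⊓ x ⨾ x ^ω) ⨾ ⊤        ≈⟨ ⨾-distrib-⊓ʳ nil (x ⨾ x ^ω) ⊤ ⟩
    nil ⨾ ⊤ ⊓ (x ⨾ x ^ω) ⨾ ⊤    ≈⟨ ⊓-cong (⨾-idˡ ⊤) (⨾-assoc x (x ^ω) ⊤) ⟩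
    ⊤ ⊓ x ⨾ x ^∞                ≈⟨ ⊓-identityˡ (x ⨾ x ^∞) ⟩
    x ⨾ x ^∞                    ∎

  ^-⨾-⊗-unfold : ∀ {a b} → Atomic a → Atomic b → ∀ {y} → y ≈ b ⨾ y →
                    ∀ x n → (a ^ n ⨾ x) ⊗ y ≈ (a ⊗ b) ^ n ⨾ (x ⊗ y)
  ^-⨾-⊗-unfold _ _ {y} _ x zero = begin
    (nil ⨾ x) ⊗ y    ≈⟨ ⊗-cong (⨾-idˡ x) Eq.refl ⟩
    x ⊗ y            ≈⟨ Eq.sym (⨾-idˡ (x ⊗ y)) ⟩
    nil ⨾ (x ⊗ y)    ∎
  ^-⨾-⊗-unfold {a} {b} atomic-a atomic-b {y} y≈b⨾y x (suc n) = begin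
    ((a ⨾ a ^ n) ⨾ x) ⊗ y              ≈⟨ ⊗-cong (⨾-assoc a (a ^ n) x) y≈b⨾y ⟩
    (a ⨾ a ^ n ⨾ x) ⊗ (b ⨾ y)          ≈⟨ ⊗-interchange atomic-a atomic-b (a ^ n ⨾ x) y ⟩
    (a ⊗ b) ⨾ ((a ^ n ⨾ x) ⊗ y)        ≈⟨ ⨾-cong Eq.refl (^-⨾-⊗-unfold atomic-a atomic-b y≈b⨾y x n) ⟩
    (a ⊗ b) ⨾ (a ⊗ b) ^ n ⨾ (x ⊗ y)    ≈⟨ Eq.sym (⨾-assoc (a ⊗ b) ((a ⊗ b) ^ n) (x ⊗ y)) ⟩
    ((a ⊗ b) ⨾ (a ⊗ b) ^ n) ⨾ (x ⊗ y)  ∎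

  ^⋆-⨾-⊗-unfold : ∀ {a b} → Atomic a → Atomic b → ∀ {y} → y ≈ b ⨾ y →
                     ∀ x → (a ^⋆ ⨾ x) ⊗ y ≈ (a ⊗ b) ^⋆ ⨾ (x ⊗ y)
  ^⋆-⨾-⊗-unfold {a} {b} atomic-a atomic-b {y} y≈b⨾y x = begin
    (a ^⋆ ⨾ x) ⊗ y                          ≈⟨ ⊗-cong (⨾-distrib-⨅ʳ _ x) Eq.refl ⟩
    (⨅ λ n → a ^ lower n ⨾ x) ⊗ y           ≈⟨ ⊗-distrib-⨅ (lift 0) _ y ⟩
    ⨅ (λ n → (a ^ lower n ⨾ x) ⊗ y)         ≈⟨ ⨅-cong (λ n → ^-⨾-⊗-unfold atomic-a atomic-b y≈b⨾y x (lower n)) ⟩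
    ⨅ (λ n → (a ⊗ b) ^ lower n ⨾ (x ⊗ y))   ≈⟨ Eq.sym (⨾-distrib-⨅ʳ _ (x ⊗ y)) ⟩
    (a ⊗ b) ^⋆ ⨾ (x ⊗ y)                    ∎

mainTheorem8 : ∀ {c ℓ₁ ℓ₂ i : Level} (C : CommandAlgebra c ℓ₁ ℓ₂ i) →
    let open CommandAlgebra C in
    ∀ {a b} → Atomic a → Atomic b → ∀ x →
    ((a ^⋆) ⨾ x) ⊗ (b ^∞) ≈ ((a ⊗ b) ^⋆) ⨾ (x ⊗ (b ^∞))
mainTheorem8 C {b = b} atomic-a atomic-b =
  ^⋆-⨾-⊗-unfold atomic-a atomic-b (^∞-unfold b)
  where open CommandAlgebraProperties C
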